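{- Let $m \neq n$ be positive integers, let $t$ be a finite nonempty sequence with values in $\{m,n\}$, let $s^{(1)}$ be a finite nonempty sequence of positive integers, and let $s^{(2)}$ be an arbitrary (finite or infinite) sequence of positive integers. Then \[ E_{m,n}(s^{(1)}s^{(2)}, t) = E_{m,n}(s^{(1)}, t)\, E_{m,n}\big(s^{(2)}, C_{m,n}(s^{(1)}, t)\big), \] where juxtaposition denotes concatenation.
   Context: For a (possibly infinite) sequence $s$, $R(s)$ denotes the sequence of run lengths of $s$ (the lengths of the maximal blocks of consecutive equal terms, in order). Let $m\neq n$ be positive integers. For a (possibly infinite) sequence $s$ of positive integers and a finite nonempty sequence $t=(t_1,\dots,t_k)$ with values in $\{m,n\}$, the expansion $E_{m,n}(s,t)$ is defined recursively: if $k=1$, $E_{m,n}(s,t)$ is the unique sequence with values in $\{m,n\}$ whose first term is $t_1$ and with $R(E_{m,n}(s,t))=s$; if $k>1$, $E_{m,n}(s,t)=E_{m,n}(E_{m,n}(s,(t_1)),(t_2,\dots,t_k))$. For a finite nonempty sequence $s$ of positive integers and $t\in\{m,n\}^k$, the torsion $C_{m,n}(s,t)$ is the sequence of length $k$ whose $i$-th term, for $i=1,\dots,k$, equals $m+n$ minus the last term of $E_{m,n}(s,(t_1,\dots,t_i))$. -}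

module Defs where

open import Data.Nat using (ℕ; zero; suc; _+_; _∸_; _<?_)
open import Data.List using (List; []; _∷_; _++_; replicate; map; upTo; take; length; last)
open import Data.Maybe using (fromMaybe)
open import Relation.Nullary using (yes; no)

-- Infinite sequences of naturals are represented as functions ℕ → ℕ
-- (term i, 0-indexed).
Seq∞ : Set
Seq∞ = ℕ → ℕ

_++∞_ : List ℕ → Seq∞ → Seq∞
([] ++∞ s) i = s i
((x ∷ xs) ++∞ s) zero = x
((x ∷ xs) ++∞ s) (suc i) = (xs ++∞ s) i

-- The value of {m,n} different from a (for a ∈ {m,n}).
swap : ℕ → ℕ → ℕ → ℕ
swap m n a = m + n ∸ a

-- One-step expansion of a finite sequence s of positive integers with first
-- value a: the unique {m,n}-sequence starting with a whose run lengths are s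
-- (s₁ copies of a, then s₂ copies of the other value, ...).
E₁ : ℕ → ℕ → List ℕ → ℕ → List ℕ
E₁ m n []       a = []
E₁ m n (k ∷ ks) a = replicate k a ++ E₁ m n ks (swap m n a)

-- Term i of the one-step expansion of an infinite sequence s with first value a.
-- The first argument is fuel; for positive s, fuel (suc i) is enough.
look : ℕ → ℕ → ℕ → Seq∞ → ℕ → ℕ → ℕ
look m n zero    s a i = a
look m n (suc f) s a i with i <? s 0
... | yes _ = a
... | no  _ = look m n f (λ j → s (suc j)) (swap m n a) (i ∸ s 0)

E₁∞ : ℕ → ℕ → Seq∞ → ℕ → Seq∞
E₁∞ m n s a i = look m n (suc i) s a i

E : ℕ → ℕ → List ℕ → List ℕ → List ℕ
E m n s []      = s
E m n s (a ∷ t) = E m n (E₁ m n s a) t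

E∞ : ℕ → ℕ → Seq∞ → List ℕ → Seq∞
E∞ m n s []      = s
E∞ m n s (a ∷ t) = E∞ m n (E₁∞ m n s a) t

-- Torsion C_{m,n}(s,t): i-th term (i = 1..k) is m + n minus the last term of
-- E_{m,n}(s,(t₁,…,tᵢ)).  (The default 0 for an empty expansion never occurs
-- for nonempty positive s.)
C : ℕ → ℕ → List ℕ → List ℕ → List ℕ
C m n s t = map (λ i → m + n ∸ fromMaybe 0 (last (E m n s (take (suc i) t)))) (upTo (length t))

-- Expanding a list of run lengths is a left-to-right process: the runs of s₁
-- are laid out first, and the only information passed on to s₂ is the value
-- the next run starts with, namely the value that follows the last one used.
-- Iterating, E(s₁ s₂, t) splits as E(s₁, t) followed by the expansion of s₂
-- along the successive start values, and the i-th start value is m + n minus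
-- the last term of E(s₁, t₁ … tᵢ), which is exactly the i-th torsion term.
-- For infinite s₂ the same induction on t runs pointwise, using that the
-- fuelled lookup defining E₁∞ does not depend on the fuel once it exceeds the index.
module Submission where

open import Defs
open import Data.Nat using (ℕ; zero; suc; _∸_; _<_; _≤_; s≤s; z≤n; _<?_)
open import Data.Nat.GeneralisedArithmetic using (iterate)
open import Data.Nat.Properties
  using (m+n∸m≡n; m+n∸n≡m; ≮⇒≥; ∸-monoʳ-<; <-≤-trans; ≤-pred; ≤-refl)
open import Data.List using (List; []; _∷_; _++_; replicate; length; last)
open import Data.List.Properties using (++-assoc; map-applyUpTo)
open import Data.List.Relation.Unary.All using (All; []; _∷_)
import Data.List.Relation.Unary.All as All
open import Data.List.Relation.Unary.All.Properties using (++⁺; replicate⁺)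
open import Data.Maybe using (just; fromMaybe)
open import Data.Sum using (_⊎_; inj₁; inj₂)
open import Data.Product using (_×_; _,_)
open import Data.Empty using (⊥-elim)
open import Function using (id; _∘′_)
open import Relation.Nullary using (yes; no)
open import Relation.Binary.PropositionalEquality
  using (_≡_; _≢_; refl; sym; trans; cong; subst; module ≡-Reasoning)

last-++-∷ : ∀ {A : Set} (xs : List A) y ys → last (xs ++ y ∷ ys) ≡ last (y ∷ ys)
last-++-∷ []           y ys = refl
last-++-∷ (x ∷ [])     y ys = refl
last-++-∷ (x ∷ x′ ∷ xs) y ys = last-++-∷ (x′ ∷ xs) y ys

last-replicate-++-[] : ∀ {A : Set} k (x : A) → last (x ∷ replicate k x ++ []) ≡ just x
last-replicate-++-[] zero    x = refl
last-replicate-++-[] (suc k) x = last-replicate-++-[] k x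

∸-<-suc : ∀ {i k f} → 0 < k → k ≤ i → i < suc f → i ∸ k < f
∸-<-suc 0<k k≤i i<1+f = <-≤-trans (∸-monoʳ-< 0<k k≤i) (≤-pred i<1+f)

++-++∞ : ∀ (xs ys : List ℕ) Y i → ((xs ++ ys) ++∞ Y) i ≡ (xs ++∞ (ys ++∞ Y)) i
++-++∞ []       ys Y i       = refl
++-++∞ (x ∷ xs) ys Y zero    = refl
++-++∞ (x ∷ xs) ys Y (suc i) = ++-++∞ xs ys Y i

replicate-++∞-< : ∀ k (x : ℕ) Y {i} → i < k → (replicate k x ++∞ Y) i ≡ x
replicate-++∞-< (suc k) x Y {zero}  _         = refl
replicate-++∞-< (suc k) x Y {suc i} (s≤s i<k) = replicate-++∞-< k x Y i<k

replicate-++∞-≥ : ∀ k (x : ℕ) Y {i} → k ≤ i → (replicate k x ++∞ Y) i ≡ Y (i ∸ k)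
replicate-++∞-≥ zero    x Y {i}     _         = refl
replicate-++∞-≥ (suc k) x Y {suc i} (s≤s k≤i) = replicate-++∞-≥ k x Y k≤i

module Expansion (m n : ℕ) where

  InPair : ℕ → Set
  InPair x = x ≡ m ⊎ x ≡ n

  swap-InPair : ∀ {a} → InPair a → InPair (swap m n a)
  swap-InPair (inj₁ refl) = inj₂ (m+n∸m≡n m n)
  swap-InPair (inj₂ refl) = inj₁ (m+n∸n≡m m n)

  iterate-swap-InPair : ∀ {a} k → InPair a → InPair (iterate (swap m n) a k)
  iterate-swap-InPair zero    p = p
  iterate-swap-InPair (suc k) p = iterate-swap-InPair k (swap-InPair p)

  E₁-InPair : ∀ s {a} → InPair a → All InPair (E₁ m n s a)
  E₁-InPair []       p = []
  E₁-InPair (k ∷ ks) p = ++⁺ (replicate⁺ k p) (E₁-InPair ks (swap-InPair p))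

  look-InPair : ∀ f s {a} i → InPair a → InPair (look m n f s a i)
  look-InPair zero    s i p = p
  look-InPair (suc f) s i p with i <? s 0
  ... | yes _ = p
  ... | no  _ = look-InPair f (λ j → s (suc j)) (i ∸ s 0) (swap-InPair p)

  E₁-≢[] : ∀ {s} a → s ≢ [] → All (0 <_) s → E₁ m n s a ≢ []
  E₁-≢[] {[]}        a s≢[] _             = ⊥-elim (s≢[] refl)
  E₁-≢[] {suc k ∷ _} a _    (s≤s z≤n ∷ _) = λ ()

  E₁-++ : ∀ s₁ s₂ a → E₁ m n (s₁ ++ s₂) a ≡ E₁ m n s₁ a ++ E₁ m n s₂ (iterate (swap m n) a (length s₁))
  E₁-++ []       s₂ a = refl
  E₁-++ (k ∷ ks) s₂ a = trans (cong (replicate k a ++_) (E₁-++ ks s₂ (swap m n a)))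
                              (sym (++-assoc (replicate k a) (E₁ m n ks (swap m n a)) _))

  swap-last-E₁ : ∀ s a → s ≢ [] → All (0 <_) s →
                 swap m n (fromMaybe 0 (last (E₁ m n s a))) ≡ iterate (swap m n) a (length s)
  swap-last-E₁ [] a s≢[] _ = ⊥-elim (s≢[] refl)
  swap-last-E₁ (suc k ∷ []) a _ _ = cong (swap m n ∘′ fromMaybe 0) (last-replicate-++-[] k a)
  swap-last-E₁ (suc k ∷ suc k′ ∷ ks) a _ (_ ∷ ps) =
    trans (cong (swap m n ∘′ fromMaybe 0) (last-++-∷ (a ∷ replicate k a) a′ (replicate k′ a′ ++ E₁ m n ks (swap m n a′))))
          (swap-last-E₁ (suc k′ ∷ ks) a′ (λ ()) ps)
    where a′ = swap m n a
  swap-last-E₁ (zero ∷ _) a _ (() ∷ _)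
  swap-last-E₁ (_ ∷ zero ∷ _) a _ (_ ∷ () ∷ _)

  C-∷ : ∀ s a t → C m n s (a ∷ t) ≡ swap m n (fromMaybe 0 (last (E₁ m n s a))) ∷ C m n (E₁ m n s a) t
  C-∷ s a t = cong (_ ∷_) (trans (map-applyUpTo suc _ (length t)) (sym (map-applyUpTo id _ (length t))))

  C-∷-iterate : ∀ s a t → s ≢ [] → All (0 <_) s →
                C m n s (a ∷ t) ≡ iterate (swap m n) a (length s) ∷ C m n (E₁ m n s a) t
  C-∷-iterate s a t s≢[] ps = trans (C-∷ s a t) (cong (_∷ C m n (E₁ m n s a) t) (swap-last-E₁ s a s≢[] ps))

  look-cong : ∀ f {s s′} a i → (∀ j → s j ≡ s′ j) → look m n f s a i ≡ look m n f s′ a i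
  look-cong zero    {s} {s′} a i eq = refl
  look-cong (suc f) {s} {s′} a i eq with i <? s 0 | i <? s′ 0
  ... | yes _   | yes _   = refl
  ... | yes i<s | no  i≮s = ⊥-elim (i≮s (subst (i <_) (eq 0) i<s))
  ... | no  i≮s | yes i<s = ⊥-elim (i≮s (subst (i <_) (sym (eq 0)) i<s))
  ... | no  _   | no  _   rewrite eq 0 = look-cong f (swap m n a) (i ∸ s′ 0) (λ j → eq (suc j))

  E∞-cong : ∀ t {s s′} → (∀ j → s j ≡ s′ j) → ∀ i → E∞ m n s t i ≡ E∞ m n s′ t i
  E∞-cong []      eq = eq
  E∞-cong (a ∷ t) eq = E∞-cong t (λ i → look-cong (suc i) a i eq)

  look-fuel : ∀ {f g} s a {i} → (∀ j → 0 < s j) → i < f → i < g → look m n f s a i ≡ look m n g s a i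
  look-fuel {suc f} {suc g} s a {i} ps i<f i<g with i <? s 0
  ... | yes _   = refl
  ... | no  i≮s = look-fuel (λ j → s (suc j)) (swap m n a) (λ j → ps (suc j))
                    (∸-<-suc (ps 0) (≮⇒≥ i≮s) i<f) (∸-<-suc (ps 0) (≮⇒≥ i≮s) i<g)

  look-++∞ : ∀ {f} s₁ s₂ a {i} → All (0 <_) s₁ → (∀ j → 0 < s₂ j) → i < f →
             look m n f (s₁ ++∞ s₂) a i ≡ (E₁ m n s₁ a ++∞ E₁∞ m n s₂ (iterate (swap m n) a (length s₁))) i
  look-++∞          []       s₂ a     _          ps₂ i<f = look-fuel s₂ a ps₂ i<f ≤-refl
  look-++∞ {suc f} (k ∷ ks) s₂ a {i} (0<k ∷ ps) ps₂ i<f with i <? k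
  ... | yes i<k = sym (trans (++-++∞ (replicate k a) (E₁ m n ks (swap m n a)) _ i) (replicate-++∞-< k a _ i<k))
  ... | no  i≮k = trans (look-++∞ ks s₂ (swap m n a) ps ps₂ (∸-<-suc 0<k (≮⇒≥ i≮k) i<f))
                        (sym (trans (++-++∞ (replicate k a) (E₁ m n ks (swap m n a)) _ i) (replicate-++∞-≥ k a _ (≮⇒≥ i≮k))))

  E₁∞-++∞ : ∀ s₁ s₂ a → All (0 <_) s₁ → (∀ j → 0 < s₂ j) →
            ∀ i → E₁∞ m n (s₁ ++∞ s₂) a i ≡ (E₁ m n s₁ a ++∞ E₁∞ m n s₂ (iterate (swap m n) a (length s₁))) i
  E₁∞-++∞ s₁ s₂ a ps ps₂ i = look-++∞ s₁ s₂ a ps ps₂ ≤-refl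

  module Positive (0<m : 0 < m) (0<n : 0 < n) where

    InPair⇒pos : ∀ {x} → InPair x → 0 < x
    InPair⇒pos (inj₁ refl) = 0<m
    InPair⇒pos (inj₂ refl) = 0<n

    E₁-pos : ∀ s {a} → InPair a → All (0 <_) (E₁ m n s a)
    E₁-pos s p = All.map InPair⇒pos (E₁-InPair s p)

    E-++ : ∀ t → All InPair t → ∀ s₁ → s₁ ≢ [] → All (0 <_) s₁ → ∀ s₂ →
           E m n (s₁ ++ s₂) t ≡ E m n s₁ t ++ E m n s₂ (C m n s₁ t)
    E-++ []      _          s₁ _    _  s₂ = refl
    E-++ (a ∷ t) (pa ∷ pt) s₁ s₁≢[] ps s₂ = begin
      E m n (E₁ m n (s₁ ++ s₂) a) t                          ≡⟨ cong (λ u → E m n u t) (E₁-++ s₁ s₂ a) ⟩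
      E m n (E₁ m n s₁ a ++ E₁ m n s₂ b) t                    ≡⟨ E-++ t pt (E₁ m n s₁ a) (E₁-≢[] a s₁≢[] ps) (E₁-pos s₁ pa) (E₁ m n s₂ b) ⟩
      E m n s₁ (a ∷ t) ++ E m n s₂ (b ∷ C m n (E₁ m n s₁ a) t) ≡⟨ cong (λ c → E m n s₁ (a ∷ t) ++ E m n s₂ c) (sym (C-∷-iterate s₁ a t s₁≢[] ps)) ⟩
      E m n s₁ (a ∷ t) ++ E m n s₂ (C m n s₁ (a ∷ t))        ∎
      where
      open ≡-Reasoning
      b = iterate (swap m n) a (length s₁)

    E₁∞-pos : ∀ s {a} → InPair a → ∀ i → 0 < E₁∞ m n s a i
    E₁∞-pos s p i = InPair⇒pos (look-InPair (suc i) s i p)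

    E∞-++∞ : ∀ t → All InPair t → ∀ s₁ → s₁ ≢ [] → All (0 <_) s₁ → ∀ s₂ → (∀ i → 0 < s₂ i) →
             ∀ i → E∞ m n (s₁ ++∞ s₂) t i ≡ (E m n s₁ t ++∞ E∞ m n s₂ (C m n s₁ t)) i
    E∞-++∞ []      _          s₁ _    _  s₂ _   i = refl
    E∞-++∞ (a ∷ t) (pa ∷ pt) s₁ s₁≢[] ps s₂ ps₂ i = begin
      E∞ m n (E₁∞ m n (s₁ ++∞ s₂) a) t i
        ≡⟨ E∞-cong t (E₁∞-++∞ s₁ s₂ a ps ps₂) i ⟩
      E∞ m n (E₁ m n s₁ a ++∞ E₁∞ m n s₂ b) t i
        ≡⟨ E∞-++∞ t pt (E₁ m n s₁ a) (E₁-≢[] a s₁≢[] ps) (E₁-pos s₁ pa) (E₁∞ m n s₂ b) (E₁∞-pos s₂ pb) i ⟩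
      (E m n s₁ (a ∷ t) ++∞ E∞ m n s₂ (b ∷ C m n (E₁ m n s₁ a) t)) i
        ≡⟨ cong (λ c → (E m n s₁ (a ∷ t) ++∞ E∞ m n s₂ c) i) (sym (C-∷-iterate s₁ a t s₁≢[] ps)) ⟩
      (E m n s₁ (a ∷ t) ++∞ E∞ m n s₂ (C m n s₁ (a ∷ t))) i ∎
      where
      open ≡-Reasoning
      b = iterate (swap m n) a (length s₁)
      pb = iterate-swap-InPair (length s₁) pa

proposition2p3 : (m n : ℕ) → 0 < m → 0 < n → m ≢ n →
    (t : List ℕ) → t ≢ [] → All (λ x → x ≡ m ⊎ x ≡ n) t →
    (s₁ : List ℕ) → s₁ ≢ [] → All (0 <_) s₁ →
    ((s₂ : List ℕ) → All (0 <_) s₂ →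
      E m n (s₁ ++ s₂) t ≡ E m n s₁ t ++ E m n s₂ (C m n s₁ t))
    × ((s₂ : Seq∞) → (∀ i → 0 < s₂ i) →
      ∀ i → E∞ m n (s₁ ++∞ s₂) t i ≡ (E m n s₁ t ++∞ E∞ m n s₂ (C m n s₁ t)) i)
proposition2p3 m n 0<m 0<n _ t _ pt s₁ s₁≢[] ps =
  (λ s₂ _ → E-++ t pt s₁ s₁≢[] ps s₂) , E∞-++∞ t pt s₁ s₁≢[] ps
  where open Expansion.Positive m n 0<m 0<n
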